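{- Fix an integer $n\ge0$ and start the chip-firing game on the quadrant lattice graph with $2^n$ chips at $(0,0)$. In the stable configuration, no vertex $(x,y)$ with $x+y<n$ holds a chip, and some vertex $(x,y)$ with $x+y=n$ holds a chip; that is, the row closest to the root containing chips is row $n$.
   Context: The quadrant lattice graph is the directed graph with vertex set $\{(x,y): x,y\in\mathbb{Z}_{\ge 0}\}$ and edges $(x,y)\to(x+1,y)$ and $(x,y)\to(x,y+1)$; the root is $(0,0)$ and row $i$ consists of vertices with $x+y=i$. In the chip-firing game, a vertex holding at least $2$ chips may fire, sending one chip to each of its two out-neighbours. Starting from $2^n$ chips at $(0,0)$ the process terminates at a stable configuration (no vertex can fire), which does not depend on the order of firings. -}

module Defs where

open import Data.Nat using (ℕ; zero; suc; _+_; _∸_; _≤_; _<_; _≟_)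
open import Data.Bool using (Bool; true; false; _∧_; if_then_else_)
open import Relation.Nullary.Decidable using (⌊_⌋)
open import Relation.Binary.Construct.Closure.ReflexiveTransitive using (Star)

Config : Set
Config = ℕ → ℕ → ℕ

_at_,_ : ℕ → ℕ → ℕ → ℕ → Bool
(x at a , b) y = ⌊ x ≟ a ⌋ ∧ ⌊ y ≟ b ⌋

initial : ℕ → Config
initial m x y = if (x at 0 , 0) y then m else 0

fire : ℕ → ℕ → Config → Config
fire a b c x y =
  ((if (x at a , b) y then c x y ∸ 2 else c x y)
    + (if (x at suc a , b) y then 1 else 0))
    + (if (x at a , suc b) y then 1 else 0)

data Step (c : Config) : Config → Set where
  step : (a b : ℕ) → 2 ≤ c a b → Step c (fire a b c)

Reaches : Config → Config → Set
Reaches = Star Step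

Stable : Config → Set
Stable c = ∀ x y → c x y < 2

{-# OPTIONS --safe #-}
-- Record a firing sequence by its odometer f, the number of times each vertex has fired;
-- then c + 2 f = c₀ + inflow f at every vertex. Chips only move to the next row, so when
-- c is stable (c < 2) this equation determines f and c row by row: a vertex receives
-- A = c₀ + inflow f chips, fires ⌊A / 2⌋ times and keeps A mod 2. From 2ⁿ chips at the
-- root, every vertex of row r < n receives a multiple of 2ⁿ⁻ʳ and (n , 0) receives exactly
-- one chip, which gives the first occupied row.
-- A stable configuration is reached by greedy firing below this canonical odometer. It has
-- finite support, since the excess Σ (A − 1)⁺ of a row strictly drops from one firing row
-- to the next. And the earliest vertex that has fired fewer times than canonically has
-- settled in-neighbours, so it holds at least 2 chips and may fire.
module Submission where

open import Defs
open import Data.Nat using (ℕ; _+_; _<_; _^_)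
open import Data.Product using (Σ; _×_; ∃-syntax)
open import Relation.Binary.PropositionalEquality using (_≡_)

open import Data.Nat
open import Data.Nat.Properties
open import Data.Nat.DivMod
open import Data.Nat.Divisibility using (_∣_; m*n∣o⇒m∣o/n; n∣m⇒m%n≡0; m∣m*n; ∣m∣n⇒∣m+n)
open import Data.Nat.Induction using (<-wellFounded)
open import Data.Nat.ListAction using (sum)
open import Data.Nat.Tactic.RingSolver using (solve-∀)
open import Data.Bool using (true; false; if_then_else_; T)
open import Data.Bool.Properties using (∧-zeroʳ; T-∧)
open import Data.List using (List; []; _∷_; map)
open import Data.List.Relation.Binary.Pointwise using (Pointwise; []; _∷_)
open import Data.Product using (_,_; proj₁; proj₂; ∃)
open import Data.Sum using (inj₁; inj₂; [_,_]′)
open import Data.Unit using (tt)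
open import Function using (_∘_)
open import Function.Bundles using (Equivalence)
open import Induction.WellFounded using (Acc; acc)
open import Relation.Binary.PropositionalEquality
  using (refl; sym; trans; cong; cong₂; subst; module ≡-Reasoning)
open import Relation.Binary.Construct.Closure.ReflexiveTransitive using (ε; _◅_; _◅◅_)
open import Relation.Nullary using (¬_; yes; no; contradiction)
open import Relation.Nullary.Decidable using (⌊_⌋; isYes≗does; toWitness; toSum)

inflow : Config → Config
inflow f zero    zero    = 0
inflow f (suc x) zero    = f x 0
inflow f zero    (suc y) = f 0 y
inflow f (suc x) (suc y) = f x (suc y) + f (suc x) y

inflow-+ : ∀ f g x y →
  inflow (λ u v → f u v + g u v) x y ≡ inflow f x y + inflow g x y
inflow-+ f g zero    zero    = refl
inflow-+ f g (suc x) zero    = refl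
inflow-+ f g zero    (suc y) = refl
inflow-+ f g (suc x) (suc y) =
  interchange (f x (suc y)) (g x (suc y)) (f (suc x) y) (g (suc x) y)
  where
  interchange : ∀ a b c d → (a + b) + (c + d) ≡ (a + c) + (b + d)
  interchange = solve-∀

inflow-cong : ∀ {f g} → (∀ x y → f x y ≡ g x y) → ∀ x y → inflow f x y ≡ inflow g x y
inflow-cong f≡g zero    zero    = refl
inflow-cong f≡g (suc x) zero    = f≡g x 0
inflow-cong f≡g zero    (suc y) = f≡g 0 y
inflow-cong f≡g (suc x) (suc y) = cong₂ _+_ (f≡g x (suc y)) (f≡g (suc x) y)

⌊suc≟suc⌋ : ∀ m n → ⌊ suc m ≟ suc n ⌋ ≡ ⌊ m ≟ n ⌋
⌊suc≟suc⌋ m n = trans (isYes≗does (suc m ≟ suc n)) (sym (isYes≗does (m ≟ n)))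

point : ℕ → ℕ → Config
point a b x y = if (x at a , b) y then 1 else 0

at-true : ∀ {x a y b} → (x at a , b) y ≡ true → x ≡ a × y ≡ b
at-true {x} {a} {y} {b} e with Equivalence.to (T-∧ {⌊ x ≟ a ⌋} {⌊ y ≟ b ⌋}) (subst T (sym e) tt)
... | x≡a , y≡b = toWitness {a? = x ≟ a} x≡a , toWitness {a? = y ≟ b} y≡b

point-self : ∀ a b → point a b a b ≡ 1
point-self a b rewrite ≟-diag {a} refl | ≟-diag {b} refl = refl

inflow-point : ∀ a b x y → inflow (point a b) x y
  ≡ (if (x at suc a , b) y then 1 else 0) + (if (x at a , suc b) y then 1 else 0)
inflow-point a b zero zero
  rewrite ∧-zeroʳ ⌊ 0 ≟ a ⌋ = refl
inflow-point a b (suc x) zero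
  rewrite ⌊suc≟suc⌋ x a | ∧-zeroʳ ⌊ suc x ≟ a ⌋ = sym (+-identityʳ _)
inflow-point a b zero (suc y)
  rewrite ⌊suc≟suc⌋ y b = refl
inflow-point a b (suc x) (suc y)
  rewrite ⌊suc≟suc⌋ x a | ⌊suc≟suc⌋ y b = refl

+-point-≤ : ∀ {f g : Config} {a b} → (∀ x y → f x y ≤ g x y) → f a b < g a b →
  ∀ x y → f x y + point a b x y ≤ g x y
+-point-≤ {f} {g} {a} {b} f≤g fab<gab x y with (x at a , b) y in e
... | false = ≤-trans (≤-reflexive (+-identityʳ (f x y))) (f≤g x y)
... | true with at-true {x} {a} {y} {b} e
...   | refl , refl = ≤-trans (≤-reflexive (+-comm (f a b) 1)) fab<gab

-- The body of fire a b c x y, with here = (x at a , b) y.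
fire-transfer : ∀ here n r u → (here ≡ true → 2 ≤ n) →
  (if here then n ∸ 2 else n) + r + u + (if here then 1 else 0) * 2 ≡ n + (r + u)
fire-transfer true n r u 2≤n = begin
  n ∸ 2 + r + u + 2   ≡⟨ move-2 (n ∸ 2) r u ⟩
  n ∸ 2 + 2 + (r + u) ≡⟨ cong (_+ (r + u)) (m∸n+n≡m (2≤n refl)) ⟩
  n + (r + u)         ∎
  where
  open ≡-Reasoning
  move-2 : ∀ k r u → k + r + u + 2 ≡ k + 2 + (r + u)
  move-2 = solve-∀
fire-transfer false n r u _ = trans (+-identityʳ _) (+-assoc n r u)

fire-balance : ∀ {c a b} → 2 ≤ c a b → ∀ x y →
  fire a b c x y + point a b x y * 2 ≡ c x y + inflow (point a b) x y
fire-balance {c} {a} {b} 2≤c x y =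
  trans (fire-transfer ((x at a , b) y) (c x y) _ _ fires-here)
        (cong (c x y +_) (sym (inflow-point a b x y)))
  where
  fires-here : (x at a , b) y ≡ true → 2 ≤ c x y
  fires-here e with at-true {x} {a} {y} {b} e
  ... | refl , refl = 2≤c

IsOdometer : Config → Config → Config → Set
IsOdometer c₀ c f = ∀ x y → c x y + f x y * 2 ≡ c₀ x y + inflow f x y

isOdometer-fire : ∀ {c₀ c f a b} → IsOdometer c₀ c f → 2 ≤ c a b →
  IsOdometer c₀ (fire a b c) (λ x y → f x y + point a b x y)
isOdometer-fire {c₀} {c} {f} {a} {b} odo 2≤c x y = begin
  c′ + (fx + px) * 2                          ≡⟨ regroup c′ fx px ⟩
  (c′ + px * 2) + fx * 2                      ≡⟨ cong (_+ fx * 2) (fire-balance 2≤c x y) ⟩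
  (c x y + inflow p x y) + fx * 2             ≡⟨ swap (c x y) (inflow p x y) (fx * 2) ⟩
  (c x y + fx * 2) + inflow p x y             ≡⟨ cong (_+ inflow p x y) (odo x y) ⟩
  (c₀ x y + inflow f x y) + inflow p x y      ≡⟨ +-assoc (c₀ x y) _ _ ⟩
  c₀ x y + (inflow f x y + inflow p x y)      ≡⟨ cong (c₀ x y +_) (inflow-+ f p x y) ⟨
  c₀ x y + inflow (λ u v → f u v + p u v) x y ∎
  where
  open ≡-Reasoning
  p = point a b
  c′ = fire a b c x y
  fx = f x y
  px = p x y
  regroup : ∀ k m n → k + (m + n) * 2 ≡ (k + n * 2) + m * 2
  regroup = solve-∀
  swap : ∀ k m n → (k + m) + n ≡ (k + n) + m
  swap = solve-∀

isOdometer-refl : ∀ c₀ → IsOdometer c₀ c₀ (λ _ _ → 0)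
isOdometer-refl c₀ zero    zero    = refl
isOdometer-refl c₀ (suc x) zero    = refl
isOdometer-refl c₀ zero    (suc y) = refl
isOdometer-refl c₀ (suc x) (suc y) = refl

isOdometer-reaches : ∀ {c₀ c c′ f} → IsOdometer c₀ c f → Reaches c c′ → ∃ (IsOdometer c₀ c′)
isOdometer-reaches odo ε                 = _ , odo
isOdometer-reaches odo (step a b 2≤c ◅ r) = isOdometer-reaches (isOdometer-fire odo 2≤c) r

halving-unique : ∀ {r q a} → r < 2 → r + q * 2 ≡ a → r ≡ a % 2 × q ≡ a / 2
halving-unique {r} {q} {a} r<2 e = r≡a%2 , *-cancelʳ-≡ q (a / 2) 2 (+-cancelˡ-≡ r _ _ quotients)
  where
  open ≡-Reasoning
  r≡a%2 : r ≡ a % 2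
  r≡a%2 = begin
    r                  ≡⟨ m<n⇒m%n≡m r<2 ⟨
    r % 2              ≡⟨ [m+kn]%n≡m%n r q 2 ⟨
    (r + q * 2) % 2    ≡⟨ cong (_% 2) e ⟩
    a % 2              ∎
  quotients : r + q * 2 ≡ r + a / 2 * 2
  quotients = begin
    r + q * 2          ≡⟨ e ⟩
    a                  ≡⟨ m≡m%n+[m/n]*n a 2 ⟩
    a % 2 + a / 2 * 2  ≡⟨ cong (_+ a / 2 * 2) r≡a%2 ⟨
    r + a / 2 * 2      ∎

remainder-unique : ∀ {r a} → r + (a / 2) * 2 ≡ a → r ≡ a % 2
remainder-unique {r} {a} e = +-cancelʳ-≡ (a / 2 * 2) r (a % 2) (trans e (m≡m%n+[m/n]*n a 2))

-- row g i = [g 0 i , g 1 (i ∸ 1) , … , g i 0]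
row : Config → ℕ → List ℕ
row g zero    = g 0 0 ∷ []
row g (suc i) = g 0 (suc i) ∷ row (λ x y → g (suc x) y) i

≤-sum-row : ∀ g x y → g x y ≤ sum (row g (x + y))
≤-sum-row g zero    zero    = m≤m+n _ 0
≤-sum-row g zero    (suc y) = m≤m+n _ _
≤-sum-row g (suc x) y       = ≤-trans (≤-sum-row (λ x y → g (suc x) y) x y) (m≤n+m _ _)

row-map : ∀ (φ : ℕ → ℕ) g i → row (λ x y → φ (g x y)) i ≡ map φ (row g i)
row-map φ g zero    = refl
row-map φ g (suc i) = cong (φ (g 0 (suc i)) ∷_) (row-map φ (λ x y → g (suc x) y) i)

-- spread p [l₀ , … , lₖ] = [p + l₀ , l₀ + l₁ , … , lₖ₋₁ + lₖ , lₖ]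
spread : ℕ → List ℕ → List ℕ
spread p []      = p ∷ []
spread p (l ∷ L) = p + l ∷ spread l L

row-suc-inflow : ∀ {G H} p i → (∀ x y → G (suc x) y ≡ inflow H (suc x) y) →
  G 0 (suc i) ≡ p + H 0 i → row G (suc i) ≡ spread p (row H i)
row-suc-inflow p zero    G≡ e = cong₂ _∷_ e (cong (_∷ []) (G≡ 0 0))
row-suc-inflow {G} {H} p (suc i) G≡ e = cong₂ _∷_ e
  (row-suc-inflow {λ x y → G (suc x) y} {λ x y → H (suc x) y} (H 0 (suc i)) i shifted (G≡ 0 (suc i)))
  where
  shifted : ∀ x y → G (suc (suc x)) y ≡ inflow (λ x y → H (suc x) y) (suc x) y
  shifted x zero    = G≡ (suc x) zero
  shifted x (suc y) = G≡ (suc x) (suc y)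

excess : List ℕ → ℕ
excess L = sum (map pred L)

Halves : List ℕ → List ℕ → Set
Halves = Pointwise (λ h l → h + h ≤ l)

halves : ∀ L → Halves (map (_/ 2) L) L
halves []      = []
halves (l ∷ L) = subst (_≤ l) (half+half (l / 2)) (m/n*n≤m l 2) ∷ halves L
  where
  half+half : ∀ q → q * 2 ≡ q + q
  half+half = solve-∀

pred-+-half : ∀ p {h l} e → h + h ≤ l → pred (p + h) + (h + e) ≤ p + (pred l + e)
pred-+-half p {zero} {l} e _ =
  +-mono-≤ (≤-trans pred[n]≤n (≤-reflexive (+-identityʳ p))) (m≤n+m e (pred l))
pred-+-half p {suc h} {suc l} e (s≤s hh≤l) = begin
  pred (p + suc h) + (suc h + e) ≡⟨ cong (λ k → pred k + (suc h + e)) (+-suc p h) ⟩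
  p + h + (suc h + e)           ≡⟨ +-assoc p h _ ⟩
  p + (h + (suc h + e))         ≡⟨ cong (p +_) (+-assoc h (suc h) e) ⟨
  p + (h + suc h + e)           ≤⟨ +-monoʳ-≤ p (+-monoˡ-≤ e hh≤l) ⟩
  p + (l + e)                   ∎
  where open ≤-Reasoning

excess-spread-≤ : ∀ p {H L} → Halves H L → excess (spread p H) ≤ p + excess L
excess-spread-≤ p []                 = +-monoˡ-≤ 0 pred[n]≤n
excess-spread-≤ p {h ∷ H} (hh≤l ∷ r) =
  ≤-trans (+-monoʳ-≤ (pred (p + h)) (excess-spread-≤ h r)) (pred-+-half p _ hh≤l)

excess-spread-< : ∀ p {H L} → 0 < p + sum H → Halves H L → excess (spread p H) < p + excess L
excess-spread-< (suc p) _ [] = +-monoˡ-< 0 (n<1+n p)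
excess-spread-< p {suc h ∷ H} _ (hh≤l ∷ r) =
  <-≤-trans (+-monoʳ-< (pred (p + suc h)) (excess-spread-< (suc h) z<s r)) (pred-+-half p _ hh≤l)
excess-spread-< (suc p) {zero ∷ H} {l ∷ L} _ (_ ∷ r) = begin-strict
  pred (suc p + 0) + excess (spread 0 H) ≡⟨ cong (_+ excess (spread 0 H)) (cong pred (+-identityʳ (suc p))) ⟩
  p + excess (spread 0 H)                ≤⟨ +-monoʳ-≤ p (excess-spread-≤ 0 r) ⟩
  p + excess L                           <⟨ +-monoˡ-< (excess L) (n<1+n p) ⟩
  suc p + excess L                       ≤⟨ +-monoʳ-≤ (suc p) (m≤n+m (excess L) (pred l)) ⟩
  suc p + (pred l + excess L)            ∎
  where open ≤-Reasoning
excess-spread-< zero {zero ∷ H} {l ∷ L} 0<ΣH (_ ∷ r) =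
  <-≤-trans (excess-spread-< 0 0<ΣH r) (m≤n+m (excess L) (pred l))

sum-half-spread-0 : ∀ L → sum L ≡ 0 → sum (map (_/ 2) (spread 0 L)) ≡ 0
sum-half-spread-0 []       _  = refl
sum-half-spread-0 (0 ∷ L)  ΣL = sum-half-spread-0 L ΣL
sum-half-spread-0 (suc l ∷ L) ()

∑< : ℕ → (ℕ → ℕ) → ℕ
∑< zero    g = 0
∑< (suc n) g = g n + ∑< n g

∑<-mono-≤ : ∀ n {g h} → (∀ i → g i ≤ h i) → ∑< n g ≤ ∑< n h
∑<-mono-≤ zero    g≤h = z≤n
∑<-mono-≤ (suc n) g≤h = +-mono-≤ (g≤h n) (∑<-mono-≤ n g≤h)

∑<-mono-< : ∀ n {g h j} → (∀ i → g i ≤ h i) → j < n → g j < h j → ∑< n g < ∑< n h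
∑<-mono-< (suc n) g≤h j<1+n gj<hj with m<1+n⇒m<n∨m≡n j<1+n
... | inj₁ j<n  = +-mono-≤-< (g≤h n) (∑<-mono-< n g≤h j<n gj<hj)
... | inj₂ refl = +-mono-<-≤ gj<hj (∑<-mono-≤ n g≤h)

^-monoʳ-∣ : ∀ b {i j} → i ≤ j → b ^ i ∣ b ^ j
^-monoʳ-∣ b {i} {j} i≤j = subst (λ k → b ^ i ∣ b ^ k) (m+[n∸m]≡n i≤j)
  (subst (b ^ i ∣_) (sym (^-distribˡ-+-* b i (j ∸ i))) (m∣m*n (b ^ (j ∸ i))))

halve-divisor : ∀ d r {m} → d * 2 ^ suc r ∣ m → d * 2 * 2 ^ r ∣ m
halve-divisor d r {m} = subst (_∣ m) (sym (*-assoc d 2 (2 ^ r)))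

-- received x y: all chips that ever arrive at (x , y) in the game started from m chips at the root.
module Canonical (m : ℕ) where

  mutual
    received : ℕ → ℕ → ℕ
    received zero    zero    = m
    received (suc x) zero    = fires x 0
    received zero    (suc y) = fires 0 y
    received (suc x) (suc y) = fires x (suc y) + fires (suc x) y

    fires : ℕ → ℕ → ℕ
    fires x y = received x y / 2

  received-inflow : ∀ x y → received x y ≡ initial m x y + inflow fires x y
  received-inflow zero    zero    = sym (+-identityʳ m)
  received-inflow (suc x) zero    = refl
  received-inflow zero    (suc y) = refl
  received-inflow (suc x) (suc y) = refl

  balance : ∀ {c f x y} → IsOdometer (initial m) c f → inflow f x y ≡ inflow fires x y →
    c x y + f x y * 2 ≡ received x y
  balance {c} {f} {x} {y} odo inflow≡ = begin
    c x y + f x y * 2                ≡⟨ odo x y ⟩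
    initial m x y + inflow f x y     ≡⟨ cong (initial m x y +_) inflow≡ ⟩
    initial m x y + inflow fires x y ≡⟨ received-inflow x y ⟨
    received x y                     ∎
    where open ≡-Reasoning

  module _ {c f : Config} (odo : IsOdometer (initial m) c f) (stable : Stable c) where

    mutual
      stable-balance : ∀ x y → c x y + f x y * 2 ≡ received x y
      stable-balance x y = balance odo (inflow-unique x y)

      odometer-unique : ∀ x y → f x y ≡ fires x y
      odometer-unique x y = proj₂ (halving-unique {q = f x y} (stable x y) (stable-balance x y))

      inflow-unique : ∀ x y → inflow f x y ≡ inflow fires x y
      inflow-unique zero    zero    = refl
      inflow-unique (suc x) zero    = odometer-unique x 0
      inflow-unique zero    (suc y) = odometer-unique 0 y
      inflow-unique (suc x) (suc y) = cong₂ _+_ (odometer-unique x (suc y)) (odometer-unique (suc x) y)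

    stable-chips : ∀ x y → c x y ≡ received x y % 2
    stable-chips x y = proj₁ (halving-unique {q = f x y} (stable x y) (stable-balance x y))

  stable-if-settled : ∀ {c f} → IsOdometer (initial m) c f → (∀ x y → f x y ≡ fires x y) → Stable c
  stable-if-settled {c} odo settled x y =
    subst (_< 2) (sym c≡received%2) (m%n<n (received x y) 2)
    where
    c≡received%2 : c x y ≡ received x y % 2
    c≡received%2 = remainder-unique (subst (λ k → c x y + k * 2 ≡ received x y) (settled x y)
                                       (balance odo (inflow-cong settled x y)))

  divisor-received : ∀ x y d → d * 2 ^ (x + y) ∣ m → d ∣ received x y
  divisor-received zero    zero    d d∣m = subst (_∣ m) (*-identityʳ d) d∣m
  divisor-received (suc x) zero    d d∣m =
    m*n∣o⇒m∣o/n d 2 (divisor-received x 0 (d * 2) (halve-divisor d (x + 0) d∣m))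
  divisor-received zero    (suc y) d d∣m =
    m*n∣o⇒m∣o/n d 2 (divisor-received 0 y (d * 2) (halve-divisor d y d∣m))
  divisor-received (suc x) (suc y) d d∣m = ∣m∣n⇒∣m+n
    (m*n∣o⇒m∣o/n d 2 (divisor-received x (suc y) (d * 2) (halve-divisor d (x + suc y) d∣m)))
    (m*n∣o⇒m∣o/n d 2 (divisor-received (suc x) y (d * 2)
      (halve-divisor d (suc (x + y)) (subst (λ r → d * 2 ^ suc r ∣ m) (+-suc x y) d∣m))))

  received-axis : ∀ x d → d * 2 ^ x ≡ m → received x 0 ≡ d
  received-axis zero    d e = trans (sym e) (*-identityʳ d)
  received-axis (suc x) d e =
    trans (cong (_/ 2) (received-axis x (d * 2) (trans (*-assoc d 2 (2 ^ x)) e))) (m*n/n≡m d 2)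

  row-fires : ∀ i → row fires i ≡ map (_/ 2) (row received i)
  row-fires = row-map (_/ 2) received

  row-received-suc : ∀ i → row received (suc i) ≡ spread 0 (row fires i)
  row-received-suc i = row-suc-inflow {received} {fires} 0 i received-suc refl
    where
    received-suc : ∀ x y → received (suc x) y ≡ inflow fires (suc x) y
    received-suc x zero    = refl
    received-suc x (suc y) = refl

  excess-received-decreasing : ∀ i → 0 < sum (row fires i) →
    excess (row received (suc i)) < excess (row received i)
  excess-received-decreasing i 0<Σ = begin-strict
    excess (row received (suc i))   ≡⟨ cong excess (row-received-suc i) ⟩
    excess (spread 0 (row fires i)) <⟨ excess-spread-< 0 0<Σ fires-halve-received ⟩
    excess (row received i)         ∎
    where
    open ≤-Reasoning
    fires-halve-received : Halves (row fires i) (row received i)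
    fires-halve-received = subst (λ H → Halves H (row received i)) (sym (row-fires i)) (halves _)

  vanishing-row-suc : ∀ i → sum (row fires i) ≡ 0 → sum (row fires (suc i)) ≡ 0
  vanishing-row-suc i Σ≡0 = begin
    sum (row fires (suc i))                       ≡⟨ cong sum (row-fires (suc i)) ⟩
    sum (map (_/ 2) (row received (suc i)))       ≡⟨ cong (sum ∘ map (_/ 2)) (row-received-suc i) ⟩
    sum (map (_/ 2) (spread 0 (row fires i)))     ≡⟨ sum-half-spread-0 (row fires i) Σ≡0 ⟩
    0                                             ∎
    where open ≡-Reasoning

  vanishing-row : ∀ i → Acc _<_ (excess (row received i)) → ∃[ R ] sum (row fires R) ≡ 0
  vanishing-row i (acc smaller) with sum (row fires i) ≟ 0
  ... | yes Σ≡0 = i , Σ≡0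
  ... | no  Σ≢0 = vanishing-row (suc i) (smaller (excess-received-decreasing i (n≢0⇒n>0 Σ≢0)))

  fires-vanish : ∃[ R ] ∀ x y → R ≤ x + y → fires x y ≡ 0
  fires-vanish with vanishing-row 0 (<-wellFounded _)
  ... | R , Σ≡0 = R , λ x y R≤x+y → n≤0⇒n≡0 (begin
    fires x y                          ≤⟨ ≤-sum-row fires x y ⟩
    sum (row fires (x + y))            ≡⟨ cong (sum ∘ row fires) (m∸n+n≡m R≤x+y) ⟨
    sum (row fires (x + y ∸ R + R))    ≡⟨ vanishing-after (x + y ∸ R) ⟩
    0                                  ∎)
    where
    open ≤-Reasoning
    vanishing-after : ∀ k → sum (row fires (k + R)) ≡ 0
    vanishing-after zero    = Σ≡0
    vanishing-after (suc k) = vanishing-row-suc (k + R) (vanishing-after k)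

module Stabilisation (m : ℕ) where
  open Canonical m

  bound : ℕ
  bound = proj₁ fires-vanish

  fires-in-box : ∀ {x y} → 0 < fires x y → x < bound × y < bound
  fires-in-box {x} {y} 0<F with bound ≤? x + y
  ... | yes R≤x+y = contradiction (subst (0 <_) (proj₂ fires-vanish x y R≤x+y) 0<F) n≮0
  ... | no  R≰x+y = m+n≤o⇒m≤o (suc x) x+y<R , ≤-<-trans (m≤n+m y x) x+y<R
    where x+y<R = ≰⇒> R≰x+y

  remaining : Config → ℕ
  remaining f = ∑< bound λ x → ∑< bound λ y → fires x y ∸ f x y

  remaining-< : ∀ {f g : Config} {a b} → (∀ x y → f x y ≤ g x y) →
    f a b < g a b → g a b ≤ fires a b → a < bound → b < bound → remaining g < remaining f
  remaining-< {a = a} f≤g fab<gab gab≤F a<R b<R =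
    ∑<-mono-< bound (λ x → ∑<-mono-≤ bound (λ y → ∸-monoʳ-≤ (fires x y) (f≤g x y))) a<R
      (∑<-mono-< bound (λ y → ∸-monoʳ-≤ (fires a y) (f≤g a y)) b<R (∸-monoʳ-< fab<gab gab≤F))

  module _ {c f : Config} (odo : IsOdometer (initial m) c f) (f≤F : ∀ x y → f x y ≤ fires x y) where

    settled : ∀ {x y} → ¬ f x y < fires x y → f x y ≡ fires x y
    settled {x} {y} f≮F = ≤-antisym (f≤F x y) (≮⇒≥ f≮F)

    unsettled-or-settled : ∀ {A : Set} x y →
      (f x y < fires x y → A) → (f x y ≡ fires x y → A) → A
    unsettled-or-settled x y unsettled-case settled-case =
      [ unsettled-case , settled-case ∘ settled ]′ (toSum (f x y <? fires x y))

    earliest-unsettled : ∀ x y → f x y < fires x y →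
      ∃[ a ] ∃[ b ] f a b < fires a b × inflow f a b ≡ inflow fires a b
    earliest-unsettled zero zero f<F = 0 , 0 , f<F , refl
    earliest-unsettled (suc x) zero f<F =
      unsettled-or-settled x 0 (earliest-unsettled x 0) λ settled-left →
      suc x , 0 , f<F , settled-left
    earliest-unsettled zero (suc y) f<F =
      unsettled-or-settled 0 y (earliest-unsettled 0 y) λ settled-below →
      0 , suc y , f<F , settled-below
    earliest-unsettled (suc x) (suc y) f<F =
      unsettled-or-settled x (suc y) (earliest-unsettled x (suc y)) λ settled-left →
      unsettled-or-settled (suc x) y (earliest-unsettled (suc x) y) λ settled-below →
      suc x , suc y , f<F , cong₂ _+_ settled-left settled-below

    unsettled-fireable : ∀ {a b} → f a b < fires a b → inflow f a b ≡ inflow fires a b → 2 ≤ c a b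
    unsettled-fireable {a} {b} f<F inflow≡ = +-cancelʳ-≤ (f a b * 2) 2 (c a b) (begin
      suc (f a b) * 2                  ≤⟨ *-monoˡ-≤ 2 f<F ⟩
      fires a b * 2                    ≤⟨ m≤n+m _ (received a b % 2) ⟩
      received a b % 2 + fires a b * 2 ≡⟨ m≡m%n+[m/n]*n (received a b) 2 ⟨
      received a b                     ≡⟨ balance odo inflow≡ ⟨
      c a b + f a b * 2                ∎)
      where open ≤-Reasoning

    fireable : ∀ {x y} → f x y < fires x y → ∃[ a ] ∃[ b ] f a b < fires a b × 2 ≤ c a b
    fireable {x} {y} f<F with earliest-unsettled x y f<F
    ... | a , b , f<F′ , inflow≡ = a , b , f<F′ , unsettled-fireable f<F′ inflow≡

  stabilise : ∀ {c f : Config} → Reaches (initial m) c → IsOdometer (initial m) c f →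
    (∀ x y → f x y ≤ fires x y) → Acc _<_ (remaining f) → ∃[ c′ ] Reaches (initial m) c′ × Stable c′
  stabilise {c} {f} reach odo f≤F (acc smaller)
    with anyUpTo? (λ x → anyUpTo? (λ y → f x y <? fires x y) bound) bound
  ... | no all-settled = c , reach , stable-if-settled odo settled-everywhere
    where
    settled-everywhere : ∀ x y → f x y ≡ fires x y
    settled-everywhere x y = settled odo f≤F λ f<F →
      let x<R , y<R = fires-in-box (≤-<-trans z≤n f<F) in all-settled (x , x<R , y , y<R , f<F)
  ... | yes (x , _ , y , _ , f<F) with fireable odo f≤F f<F
  ...   | a , b , f<F′ , 2≤c =
    stabilise (reach ◅◅ step a b 2≤c ◅ ε) (isOdometer-fire odo 2≤c) (+-point-≤ f≤F f<F′)
      (smaller (remaining-< {a = a} {b = b} (λ x y → m≤m+n (f x y) _) bumped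
                                           (+-point-≤ f≤F f<F′ a b) a<R b<R))
    where
    a<R = proj₁ (fires-in-box {a} {b} (≤-<-trans z≤n f<F′))
    b<R = proj₂ (fires-in-box {a} {b} (≤-<-trans z≤n f<F′))
    bumped : f a b < f a b + point a b a b
    bumped rewrite point-self a b = m<m+n (f a b) z<s

  stabilisation : ∃[ c ] Reaches (initial m) c × Stable c
  stabilisation = stabilise ε (isOdometer-refl (initial m)) (λ _ _ → z≤n) (<-wellFounded _)

corollary5p2 : (n : ℕ) →
    (Σ Config λ c → Reaches (initial (2 ^ n)) c × Stable c)
    × (∀ (c : Config) → Reaches (initial (2 ^ n)) c → Stable c →
    (∀ x y → x + y < n → c x y ≡ 0)
    × (∃[ x ] ∃[ y ] (x + y ≡ n × 0 < c x y)))
corollary5p2 n = stabilisation , first-occupied-row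
  where
  open Canonical (2 ^ n)
  open Stabilisation (2 ^ n)

  received-n-0 : received n 0 ≡ 1
  received-n-0 = received-axis n 1 (*-identityˡ (2 ^ n))

  received-even : ∀ x y → x + y < n → received x y % 2 ≡ 0
  received-even x y x+y<n = n∣m⇒m%n≡0 (received x y) 2 (divisor-received x y 2 (^-monoʳ-∣ 2 x+y<n))

  first-occupied-row : ∀ c → Reaches (initial (2 ^ n)) c → Stable c →
    (∀ x y → x + y < n → c x y ≡ 0) × (∃[ x ] ∃[ y ] (x + y ≡ n × 0 < c x y))
  first-occupied-row c reach stable =
      (λ x y x+y<n → trans (chips x y) (received-even x y x+y<n))
    , n , 0 , +-identityʳ n , subst (0 <_) (sym (trans (chips n 0) (cong (_% 2) received-n-0))) z<s
    where
    chips : ∀ x y → c x y ≡ received x y % 2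
    chips = stable-chips (proj₂ (isOdometer-reaches (isOdometer-refl (initial (2 ^ n))) reach)) stable
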